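{- Let $G$ be a finite simple graph of order $n(G)$ that is neither edgeless nor complete, and let $\overline{G}$ denote its complement. Then ${\rm vs}_{\chi}(G) + {\rm vs}_{\chi}(\overline{G}) \leq n(G) + 1$.
   Context: The chromatic vertex stability number ${\rm vs}_{\chi}(G)$ of a graph $G$ is the minimum number of vertices of $G$ whose deletion results in a graph $H$ with $\chi(H) = \chi(G)-1$, where $\chi$ denotes the chromatic number. -}

module Defs where

open import Data.Nat using (ℕ; _≤_; _∸_)
open import Data.Bool using (Bool; true; false; not; _∧_)
open import Data.Fin using (Fin; _≟_)
open import Data.Fin.Subset using (Subset; _∈_; ∁; ⊤; ∣_∣)
open import Data.Product using (Σ; ∃; _×_; _,_)
open import Relation.Nullary using (¬_; does)
open import Relation.Binary.PropositionalEquality using (_≡_; _≢_; refl; cong; cong₂; sym)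

record Graph (n : ℕ) : Set where
  field
    adj     : Fin n → Fin n → Bool
    symm    : ∀ u v → adj u v ≡ adj v u
    irrefl  : ∀ u → adj u u ≡ false
open Graph public

private
  ≟-sym : ∀ {n} (u v : Fin n) → does (u ≟ v) ≡ does (v ≟ u)
  ≟-sym u v with u ≟ v | v ≟ u
  ... | Relation.Nullary.yes _ | Relation.Nullary.yes _ = refl
  ... | Relation.Nullary.no _  | Relation.Nullary.no _  = refl
  ... | Relation.Nullary.yes p | Relation.Nullary.no q  = Data.Empty.⊥-elim (q (sym p))
    where import Data.Empty
  ... | Relation.Nullary.no p  | Relation.Nullary.yes q = Data.Empty.⊥-elim (p (sym q))
    where import Data.Empty

  compl-irrefl : ∀ {n} (G : Graph n) (u : Fin n) →
                 not (adj G u u) ∧ not (does (u ≟ u)) ≡ false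
  compl-irrefl G u with u ≟ u
  ... | Relation.Nullary.yes _ = Data.Bool.Properties.∧-zeroʳ _
    where import Data.Bool.Properties
  ... | Relation.Nullary.no ¬p = Data.Empty.⊥-elim (¬p refl)
    where import Data.Empty

complement : ∀ {n} → Graph n → Graph n
complement G = record
  { adj    = λ u v → not (adj G u v) ∧ not (does (u ≟ v))
  ; symm   = λ u v → cong₂ (λ a b → not a ∧ not b) (symm G u v) (≟-sym u v)
  ; irrefl = compl-irrefl G
  }

Edgeless : ∀ {n} → Graph n → Set
Edgeless {n} G = ∀ (u v : Fin n) → adj G u v ≡ false

Complete : ∀ {n} → Graph n → Set
Complete {n} G = ∀ (u v : Fin n) → u ≢ v → adj G u v ≡ true

ColourableOn : ∀ {n} → Graph n → Subset n → ℕ → Set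
ColourableOn {n} G R k =
  Σ ((v : Fin n) → v ∈ R → Fin k) λ c →
    ∀ u v (u∈R : u ∈ R) (v∈R : v ∈ R) → adj G u v ≡ true → c u u∈R ≢ c v v∈R

IsChromaticOn : ∀ {n} → Graph n → Subset n → ℕ → Set
IsChromaticOn G R k = ColourableOn G R k × (∀ m → ColourableOn G R m → k ≤ m)

ChiReducing : ∀ {n} → Graph n → Subset n → Set
ChiReducing G D = ∃ λ k → IsChromaticOn G ⊤ k × IsChromaticOn G (∁ D) (k ∸ 1)

IsVsChi : ∀ {n} → Graph n → ℕ → Set
IsVsChi {n} G s =
  (∃ λ (D : Subset n) → ChiReducing G D × ∣ D ∣ ≡ s) ×
  (∀ (D : Subset n) → ChiReducing G D → s ≤ ∣ D ∣)

{-# OPTIONS --safe #-}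
module Submission where

-- Every colour class of an optimal colouring of G is χ-reducing: the other
-- colours still colour the rest, and a colouring of the rest with fewer colours
-- would extend to G by giving the class one new colour. So vs_χ(G) ≤ |I| for
-- an independent set I of G, and likewise vs_χ(Ḡ) ≤ |K| for a clique K of G.
-- An independent set and a clique share at most one vertex, whence
-- |I| + |K| = |I ∪ K| + |I ∩ K| ≤ n + 1.

open import Defs
open import Data.Nat using (ℕ; _+_; _≤_; suc; zero; z≤n; s≤s⁻¹)
open import Data.Nat.Properties using (≤-trans; ≤-reflexive; +-mono-≤; +-suc; +-comm; module ≤-Reasoning)
open import Data.Bool using (true; false)
open import Function using (_∘_)
open import Data.Fin using (Fin; _≟_; punchOut)
  renaming (zero to fzero; suc to fsuc)
open import Data.Fin.Properties using (suc-injective; punchOut-injective)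
open import Data.Fin.Subset using (Subset; _∈_; _∉_; ∁; ⊤; ∣_∣; _∪_; _∩_; ⁅_⁆; inside; outside)
open import Data.Fin.Subset.Properties
  using (∈⊤; _∈?_; x∈∁p⇒x∉p; x∉p⇒x∈∁p; ∣p∣≤n; ∣⊥∣≡0; ∣⁅x⁆∣≡1; p⊆q⇒∣p∣≤∣q∣;
         nonempty?; Empty-unique; x∈⁅x⁆; x∈p∩q⁻)
open import Data.Vec using (tabulate; []; _∷_)
open import Data.Vec.Properties using (lookup∘tabulate; []=⇒lookup; lookup⇒[]=)
open import Data.Product using (∃; _×_; _,_; proj₁; proj₂)
open import Relation.Nullary using (¬_; yes; no; does; contradiction)
open import Relation.Nullary.Decidable using (dec-true)
open import Relation.Binary.PropositionalEquality using (_≡_; _≢_; refl; cong; sym; trans; subst; module ≡-Reasoning)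

∣p∪q∣+∣p∩q∣≡∣p∣+∣q∣ : ∀ {n} (p q : Subset n) → ∣ p ∪ q ∣ + ∣ p ∩ q ∣ ≡ ∣ p ∣ + ∣ q ∣
∣p∪q∣+∣p∩q∣≡∣p∣+∣q∣ []            []            = refl
∣p∪q∣+∣p∩q∣≡∣p∣+∣q∣ (inside  ∷ p) (inside  ∷ q) = cong suc (begin
  ∣ p ∪ q ∣ + suc ∣ p ∩ q ∣  ≡⟨ +-suc ∣ p ∪ q ∣ ∣ p ∩ q ∣ ⟩
  suc (∣ p ∪ q ∣ + ∣ p ∩ q ∣) ≡⟨ cong suc (∣p∪q∣+∣p∩q∣≡∣p∣+∣q∣ p q) ⟩
  suc (∣ p ∣ + ∣ q ∣)         ≡⟨ +-suc ∣ p ∣ ∣ q ∣ ⟨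
  ∣ p ∣ + suc ∣ q ∣           ∎)
  where open ≡-Reasoning
∣p∪q∣+∣p∩q∣≡∣p∣+∣q∣ (inside  ∷ p) (outside ∷ q) = cong suc (∣p∪q∣+∣p∩q∣≡∣p∣+∣q∣ p q)
∣p∪q∣+∣p∩q∣≡∣p∣+∣q∣ (outside ∷ p) (inside  ∷ q) =
  trans (cong suc (∣p∪q∣+∣p∩q∣≡∣p∣+∣q∣ p q)) (sym (+-suc ∣ p ∣ ∣ q ∣))
∣p∪q∣+∣p∩q∣≡∣p∣+∣q∣ (outside ∷ p) (outside ∷ q) = ∣p∪q∣+∣p∩q∣≡∣p∣+∣q∣ p q

subsingleton⇒∣p∣≤1 : ∀ {n} (p : Subset n) → (∀ {x y} → x ∈ p → y ∈ p → x ≡ y) → ∣ p ∣ ≤ 1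
subsingleton⇒∣p∣≤1 {n} p unique with nonempty? p
... | yes (x , x∈p) =
  ≤-trans (p⊆q⇒∣p∣≤∣q∣ (λ y∈p → subst (_∈ ⁅ x ⁆) (unique x∈p y∈p) (x∈⁅x⁆ x)))
          (≤-reflexive (∣⁅x⁆∣≡1 x))
... | no empty rewrite Empty-unique empty | ∣⊥∣≡0 n = z≤n

Independent : ∀ {n} → Graph n → Subset n → Set
Independent G S = ∀ {u v} → u ∈ S → v ∈ S → adj G u v ≢ true

nonadjacent⇒adj-complement : ∀ {n} (G : Graph n) {u v} → u ≢ v → adj G u v ≢ true →
                             adj (complement G) u v ≡ true
nonadjacent⇒adj-complement G {u} {v} u≢v ¬uv with adj G u v | u ≟ v
... | true  | _      = contradiction refl ¬uv
... | false | yes eq = contradiction eq u≢v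
... | false | no _   = refl

independent∩co-independent-unique : ∀ {n} (G : Graph n) {S T : Subset n} →
  Independent G S → Independent (complement G) T →
  ∀ {x y} → x ∈ S ∩ T → y ∈ S ∩ T → x ≡ y
independent∩co-independent-unique G {S} {T} indS indT {x} {y} x∈S∩T y∈S∩T
  with x∈p∩q⁻ S T x∈S∩T | x∈p∩q⁻ S T y∈S∩T | x ≟ y
... | _         | _         | yes x≡y = x≡y
... | x∈S , x∈T | y∈S , y∈T | no  x≢y =
  contradiction (nonadjacent⇒adj-complement G x≢y (indS x∈S y∈S)) (indT x∈T y∈T)

¬ColourableOn⊤-0 : ∀ {n} (G : Graph (suc n)) → ¬ ColourableOn G ⊤ 0
¬ColourableOn⊤-0 G (c , _) with c fzero ∈⊤
... | ()

colourable-∁-independent⇒colourable : ∀ {n} (G : Graph n) {S : Subset n} {m} →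
  Independent G S → ColourableOn G (∁ S) m → ColourableOn G ⊤ (suc m)
colourable-∁-independent⇒colourable G {S} {m} indS (d , d-proper) = c , c-proper
  where
  c : (v : Fin _) → v ∈ ⊤ → Fin (suc m)
  c v _ with v ∈? S
  ... | yes _   = fzero
  ... | no  v∉S = fsuc (d v (x∉p⇒x∈∁p v∉S))

  c-proper : ∀ u v (u∈⊤ : u ∈ ⊤) (v∈⊤ : v ∈ ⊤) → adj G u v ≡ true → c u u∈⊤ ≢ c v v∈⊤
  c-proper u v _ _ uv with u ∈? S | v ∈? S
  ... | yes u∈S | yes v∈S = λ _ → indS u∈S v∈S uv
  ... | yes _   | no  _   = λ ()
  ... | no  _   | yes _   = λ ()
  ... | no  _   | no  _   = d-proper u v _ _ uv ∘ suc-injective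

module ColourClass {n} (G : Graph n) {k} (χ : ColourableOn G ⊤ (suc k)) (i : Fin (suc k)) where

  colour : Fin n → Fin (suc k)
  colour v = proj₁ χ v ∈⊤

  colourClass : Subset n
  colourClass = tabulate (λ v → does (colour v ≟ i))

  ∈-colourClass⁻ : ∀ {v} → v ∈ colourClass → colour v ≡ i
  ∈-colourClass⁻ {v} v∈C
    with colour v ≟ i | trans (sym (lookup∘tabulate (λ w → does (colour w ≟ i)) v)) ([]=⇒lookup v∈C)
  ... | yes cv≡i | _ = cv≡i
  ... | no  _    | ()

  ∉-colourClass⁻ : ∀ {v} → v ∉ colourClass → colour v ≢ i
  ∉-colourClass⁻ {v} v∉C cv≡i =
    v∉C (lookup⇒[]= v colourClass
      (trans (lookup∘tabulate (λ w → does (colour w ≟ i)) v) (dec-true (colour v ≟ i) cv≡i)))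

  colourClass-independent : Independent G colourClass
  colourClass-independent {u} {v} u∈C v∈C uv =
    proj₂ χ u v ∈⊤ ∈⊤ uv (trans (∈-colourClass⁻ u∈C) (sym (∈-colourClass⁻ v∈C)))

  colourable-∁-colourClass : ColourableOn G (∁ colourClass) k
  colourable-∁-colourClass = c , c-proper
    where
    i≢colour : ∀ {v} → v ∈ ∁ colourClass → i ≢ colour v
    i≢colour v∈∁C = ∉-colourClass⁻ (x∈∁p⇒x∉p v∈∁C) ∘ sym

    c : (v : Fin n) → v ∈ ∁ colourClass → Fin k
    c v v∈∁C = punchOut (i≢colour v∈∁C)

    c-proper : ∀ u v (u∈∁C : u ∈ ∁ colourClass) (v∈∁C : v ∈ ∁ colourClass) →
               adj G u v ≡ true → c u u∈∁C ≢ c v v∈∁C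
    c-proper u v u∈∁C v∈∁C uv = proj₂ χ u v ∈⊤ ∈⊤ uv ∘ punchOut-injective (i≢colour u∈∁C) (i≢colour v∈∁C)

colourClass-chiReducing : ∀ {n} (G : Graph n) {k} (opt : IsChromaticOn G ⊤ (suc k)) (i : Fin (suc k)) →
                          ChiReducing G (ColourClass.colourClass G (proj₁ opt) i)
colourClass-chiReducing G {k} (χ , minimal) i =
  suc k , (χ , minimal) , colourable-∁-colourClass , λ m col →
    s≤s⁻¹ (minimal (suc m) (colourable-∁-independent⇒colourable G colourClass-independent col))
  where open ColourClass G χ i

chromatic⇒independent-chiReducing : ∀ {n} (G : Graph (suc n)) {k} → IsChromaticOn G ⊤ k →
                                    ∃ λ S → Independent G S × ChiReducing G S
chromatic⇒independent-chiReducing G {zero}  (χ , _) = contradiction χ (¬ColourableOn⊤-0 G)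
chromatic⇒independent-chiReducing G {suc k} opt     =
  colourClass , colourClass-independent , colourClass-chiReducing G opt fzero
  where open ColourClass G (proj₁ opt) fzero

vsχ≤n : ∀ {n} (G : Graph n) {s} → IsVsChi G s → s ≤ n
vsχ≤n G ((D , _ , ∣D∣≡s) , _) = subst (_≤ _) ∣D∣≡s (∣p∣≤n D)

proposition4p2 : ∀ (n : ℕ) (G : Graph n) → ¬ Edgeless G → ¬ Complete G →
    ∀ (a b : ℕ) → IsVsChi G a → IsVsChi (complement G) b → a + b ≤ suc n
proposition4p2 zero G _ _ a b vsG vsGᶜ =
  ≤-trans (+-mono-≤ (vsχ≤n G vsG) (vsχ≤n (complement G) vsGᶜ)) z≤n
proposition4p2 (suc n) G _ _ a b ((_ , (_ , χG , _) , _) , a-min) ((_ , (_ , χGᶜ , _) , _) , b-min)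
  with chromatic⇒independent-chiReducing G χG | chromatic⇒independent-chiReducing (complement G) χGᶜ
... | I , I-independent , I-reducing | K , K-independent , K-reducing = begin
  a + b                 ≤⟨ +-mono-≤ (a-min I I-reducing) (b-min K K-reducing) ⟩
  ∣ I ∣ + ∣ K ∣         ≡⟨ ∣p∪q∣+∣p∩q∣≡∣p∣+∣q∣ I K ⟨
  ∣ I ∪ K ∣ + ∣ I ∩ K ∣ ≤⟨ +-mono-≤ (∣p∣≤n (I ∪ K)) ∣I∩K∣≤1 ⟩
  suc n + 1             ≡⟨ +-comm (suc n) 1 ⟩
  suc (suc n)           ∎
  where
  open ≤-Reasoning
  ∣I∩K∣≤1 : ∣ I ∩ K ∣ ≤ 1
  ∣I∩K∣≤1 = subsingleton⇒∣p∣≤1 (I ∩ K) (independent∩co-independent-unique G I-independent K-independent)
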